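{- The weights $\omega_1 = \{u', v', w'\}$ and $\omega_2 = \{x', y', z'\}$ are pseudo-flippable if and only if there exist bijections $\phi_1:\{u,v,w\} \to \{u',v',w'\}$ and $\phi_2:\{x,y,z\} \to \{x',y',z'\}$ (from sets of three labels onto the elements of $\omega_1$ and $\omega_2$) such that (1) $\phi_1(u) \equiv -\phi_2(x) \mod d$ (2) $\phi_1(v) + \phi_2(y) \equiv 1 \mod d$, and (3) $\phi_1(w) + \phi_2(z) \equiv 1 \mod d$.
   Context: Let $\mathcal{L}_d = \frac{1}{d}\mathbb{Z}\times\frac{1}{d}\mathbb{Z}$; a triangle is $d$-minimal if it meets $\mathcal{L}_d$ only in its vertices. For an oriented $d$-minimal edge from $p=(w/d,x/d)$ to $q=(y/d,z/d)$ its weight is $\det\begin{pmatrix} w & y\\ x & z\end{pmatrix} \bmod d$, and the weight of a $d$-minimal triangle is the multiset of weights of its edges oriented counterclockwise. A $d$-weight class is a multiset $\omega$ equal to the weight of some $d$-minimal triangle. Two $d$-weight classes $\omega_1,\omega_2$ are pseudo-flippable if there exist adjacent $d$-minimal triangles in $\mathbb{R}^2$ with weights $\omega_1$ and $\omega_2$ that together form a parallelogram. Here $\omega_1 = \{u',v',w'\}$ and $\omega_2=\{x',y',z'\}$ are $d$-weight classes. -}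

module Defs where

open import Data.Nat as ℕ using (ℕ; NonZero)
open import Data.Integer as ℤ using (ℤ; _-_; _*_; _+_; _≤_; +_; _%ℕ_)
open import Data.Product using (_×_; _,_; ∃-syntax; Σ-syntax)
open import Data.Sum using (_⊎_)
open import Data.List using (List; []; _∷_)
open import Data.List.Relation.Binary.Permutation.Propositional using (_↭_)
open import Relation.Binary.PropositionalEquality using (_≡_; _≢_)
open import Relation.Nullary using (yes; no)

-- A point of L_d = (1/d)ℤ × (1/d)ℤ is represented by its numerators:
-- the pair (w , x) stands for the point (w/d , x/d).
Point : Set
Point = ℤ × ℤ

det : Point → Point → ℤ
det (w , x) (y , z) = w * z - y * x

_⊖_ : Point → Point → Point
(a , b) ⊖ (c , e) = (a - c , b - e)

-- twice the signed area of (A, B, C); positive iff A,B,C counterclockwise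
orient : Point → Point → Point → ℤ
orient A B C = det (B ⊖ A) (C ⊖ A)

record Triangle : Set where
  constructor tri
  field
    p q r : Point
open Triangle public

vertices : Triangle → List Point
vertices (tri P Q R) = P ∷ Q ∷ R ∷ []

NonDegenerate : Triangle → Set
NonDegenerate (tri P Q R) = orient P Q R ≢ + 0

InTriangle : Point → Triangle → Set
InTriangle X (tri P Q R) =
  (+ 0 ≤ orient P Q X × + 0 ≤ orient Q R X × + 0 ≤ orient R P X)
  ⊎ (orient P Q X ≤ + 0 × orient Q R X ≤ + 0 × orient R P X ≤ + 0)

Minimal : Triangle → Set
Minimal T@(tri P Q R) =
  NonDegenerate T × (∀ X → InTriangle X T → X ≡ P ⊎ X ≡ Q ⊎ X ≡ R)

edgeWeight : (d : ℕ) .{{_ : NonZero d}} → Point → Point → ℕ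
edgeWeight d P Q = det P Q %ℕ d

-- weight of a triangle: multiset (list up to permutation) of the weights of its
-- edges oriented counterclockwise
weight : (d : ℕ) .{{_ : NonZero d}} → Triangle → List ℕ
weight d (tri P Q R) with ℤ.0ℤ ℤ.<? orient P Q R
... | yes _ = edgeWeight d P Q ∷ edgeWeight d Q R ∷ edgeWeight d R P ∷ []
... | no _  = edgeWeight d P R ∷ edgeWeight d R Q ∷ edgeWeight d Q P ∷ []

WeightClass : (d : ℕ) .{{_ : NonZero d}} → List ℕ → Set
WeightClass d ω = ∃[ T ] (Minimal T × weight d T ↭ ω)

-- T₁ and T₂ are adjacent and together form a parallelogram:
-- T₁ = {P,Q,R}, T₂ = {P,R,S} share the edge PR (a diagonal) and P + R = Q + S
FormParallelogram : Triangle → Triangle → Set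
FormParallelogram T₁ T₂ =
  ∃[ P ] ∃[ Q ] ∃[ R ] ∃[ S ]
    ( vertices T₁ ↭ (P ∷ Q ∷ R ∷ [])
    × vertices T₂ ↭ (P ∷ R ∷ S ∷ [])
    × P ⊖ Q ≡ S ⊖ R )

PseudoFlippable : (d : ℕ) .{{_ : NonZero d}} → List ℕ → List ℕ → Set
PseudoFlippable d ω₁ ω₂ =
  ∃[ T₁ ] ∃[ T₂ ]
    ( Minimal T₁ × Minimal T₂
    × weight d T₁ ↭ ω₁ × weight d T₂ ↭ ω₂
    × FormParallelogram T₁ T₂ )

module Submission where

-- Points of L_d are represented by their numerators, so a d-minimal triangle is a lattice
-- triangle of ℤ² containing no lattice points besides its vertices. Three facts drive the proof.
--  * Unimodularity: a minimal triangle P Q R has orient P Q R = ±1. If the area k were ≥ 2, the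
--    sides would span a proper sublattice; reducing a unit point modulo that sublattice gives a
--    point whose barycentric coordinates (scaled by k) lie in [0, k), possibly after a point
--    reflection, i.e. a lattice point of the triangle that is not a vertex.
--  * The second triangle P R S of the parallelogram, S = P + R - Q, is the point reflection of
--    P Q R through the midpoint of P R, hence again minimal with the same orientation.
--  * For orient P Q R = 1 the edge determinants satisfy det R P + det P R = 0 and
--    det P Q + det R S = det Q R + det S P = 1; reduced mod d these are the three congruences.
-- A pseudo-flip is first brought to a normal form `Flip` (a positive triangle and its reflection).
-- The congruences then follow from the identities. Conversely, rotate a positive triangle of
-- weight ω₁ so that u sits on the diagonal R P; since residues below d cancel, the congruences
-- force x, y, z to be the weights of the reflected triangle.

open import Defs
open import Data.Nat using (ℕ; NonZero)
open import Data.Product using (_×_; ∃-syntax)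
open import Data.List using (List; []; _∷_)
open import Data.List.Relation.Binary.Permutation.Propositional using (_↭_)
open import Relation.Binary.PropositionalEquality using (_≡_)

module Geometry where

  open import Data.Integer using (ℤ; -_; _+_; _-_; _*_; 0ℤ; _≤_)
  open import Data.Integer.Properties using (neg-involutive; neg-mono-≤; +-comm)
  open import Data.Integer.Tactic.RingSolver using (solve-∀)
  open import Data.Product using (_×_; _,_; proj₁; proj₂)
  open import Data.Sum using (_⊎_; inj₁; inj₂)
  open import Relation.Binary.PropositionalEquality
    using (_≡_; refl; sym; trans; cong; cong₂; subst; subst₂; module ≡-Reasoning)

  _⊕_ : Point → Point → Point
  (a , b) ⊕ (c , e) = (a + c , b + e)

  -- The point reflection through the midpoint of the pair whose sum is c.
  reflect : Point → Point → Point
  reflect c X = c ⊖ X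

  fourth : Point → Point → Point → Point
  fourth P Q R = reflect (P ⊕ R) Q

  orient-rotate : ∀ P Q R → orient Q R P ≡ orient P Q R
  orient-rotate (p₁ , p₂) (q₁ , q₂) (r₁ , r₂) = identity p₁ p₂ q₁ q₂ r₁ r₂
    where
    identity : ∀ p₁ p₂ q₁ q₂ r₁ r₂ →
      (r₁ - q₁) * (p₂ - q₂) - (p₁ - q₁) * (r₂ - q₂) ≡ (q₁ - p₁) * (r₂ - p₂) - (r₁ - p₁) * (q₂ - p₂)
    identity = solve-∀

  orient-reverse : ∀ P Q X → orient Q P X ≡ - orient P Q X
  orient-reverse (p₁ , p₂) (q₁ , q₂) (x₁ , x₂) = identity p₁ p₂ q₁ q₂ x₁ x₂
    where
    identity : ∀ p₁ p₂ q₁ q₂ x₁ x₂ →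
      (p₁ - q₁) * (x₂ - q₂) - (x₁ - q₁) * (p₂ - q₂) ≡ - ((q₁ - p₁) * (x₂ - p₂) - (x₁ - p₁) * (q₂ - p₂))
    identity = solve-∀

  orient-swap : ∀ P Q R → orient P R Q ≡ - orient P Q R
  orient-swap P Q R =
    trans (orient-reverse R P Q) (cong -_ (trans (orient-rotate Q R P) (orient-rotate P Q R)))

  orient-reverse-order : ∀ P Q R → orient R Q P ≡ - orient P Q R
  orient-reverse-order P Q R =
    trans (orient-swap R P Q) (cong -_ (trans (orient-rotate Q R P) (orient-rotate P Q R)))

  -- A point reflection is a rotation by π, so it preserves orientation.
  orient-reflect : ∀ c A B C → orient (reflect c A) (reflect c B) (reflect c C) ≡ orient A B C
  orient-reflect (c₁ , c₂) (a₁ , a₂) (b₁ , b₂) (x₁ , x₂) = identity c₁ c₂ a₁ a₂ b₁ b₂ x₁ x₂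
    where
    identity : ∀ c₁ c₂ a₁ a₂ b₁ b₂ x₁ x₂ →
      ((c₁ - b₁) - (c₁ - a₁)) * ((c₂ - x₂) - (c₂ - a₂)) - ((c₁ - x₁) - (c₁ - a₁)) * ((c₂ - b₂) - (c₂ - a₂))
        ≡ (b₁ - a₁) * (x₂ - a₂) - (x₁ - a₁) * (b₂ - a₂)
    identity = solve-∀

  reflect-involutive : ∀ c X → reflect c (reflect c X) ≡ X
  reflect-involutive (c₁ , c₂) (x₁ , x₂) = cong₂ _,_ (identity c₁ x₁) (identity c₂ x₂)
    where
    identity : ∀ c x → c - (c - x) ≡ x
    identity = solve-∀

  reflect-left : ∀ P R → reflect (P ⊕ R) P ≡ R
  reflect-left (p₁ , p₂) (r₁ , r₂) = cong₂ _,_ (identity p₁ r₁) (identity p₂ r₂)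
    where
    identity : ∀ p r → (p + r) - p ≡ r
    identity = solve-∀

  reflect-right : ∀ P R → reflect (P ⊕ R) R ≡ P
  reflect-right (p₁ , p₂) (r₁ , r₂) = cong₂ _,_ (identity p₁ r₁) (identity p₂ r₂)
    where
    identity : ∀ p r → (p + r) - r ≡ p
    identity = solve-∀

  SameSign : ℤ → ℤ → ℤ → Set
  SameSign a b c = (0ℤ ≤ a × 0ℤ ≤ b × 0ℤ ≤ c) ⊎ (a ≤ 0ℤ × b ≤ 0ℤ × c ≤ 0ℤ)

  sameSign-cong : ∀ {a b c a′ b′ c′} → a ≡ a′ → b ≡ b′ → c ≡ c′ → SameSign a b c → SameSign a′ b′ c′
  sameSign-cong refl refl refl s = s

  sameSign-rotate : ∀ {a b c} → SameSign a b c → SameSign c a b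
  sameSign-rotate (inj₁ (a , b , c)) = inj₁ (c , a , b)
  sameSign-rotate (inj₂ (a , b , c)) = inj₂ (c , a , b)

  sameSign-flip : ∀ {a b c} → SameSign (- c) (- b) (- a) → SameSign a b c
  sameSign-flip (inj₁ (c′ , b′ , a′)) = inj₂ (nonpositive a′ , nonpositive b′ , nonpositive c′)
    where
    nonpositive : ∀ {x} → 0ℤ ≤ - x → x ≤ 0ℤ
    nonpositive {x} h = subst (_≤ 0ℤ) (neg-involutive x) (neg-mono-≤ h)
  sameSign-flip (inj₂ (c′ , b′ , a′)) = inj₁ (nonnegative a′ , nonnegative b′ , nonnegative c′)
    where
    nonnegative : ∀ {x} → - x ≤ 0ℤ → 0ℤ ≤ x
    nonnegative {x} h = subst (0ℤ ≤_) (neg-involutive x) (neg-mono-≤ h)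

  minimal-rotate : ∀ {P Q R} → Minimal (tri P Q R) → Minimal (tri Q R P)
  minimal-rotate {P} {Q} {R} (nondegenerate , empty) =
    (λ e → nondegenerate (trans (sym (orient-rotate P Q R)) e)) ,
    λ X inside → relabel (empty X (sameSign-rotate inside))
    where
    relabel : ∀ {X} → X ≡ P ⊎ X ≡ Q ⊎ X ≡ R → X ≡ Q ⊎ X ≡ R ⊎ X ≡ P
    relabel (inj₁ e)        = inj₂ (inj₂ e)
    relabel (inj₂ (inj₁ e)) = inj₁ e
    relabel (inj₂ (inj₂ e)) = inj₂ (inj₁ e)

  minimal-swap : ∀ {P Q R} → Minimal (tri P Q R) → Minimal (tri P R Q)
  minimal-swap {P} {Q} {R} (nondegenerate , empty) =
    (λ e → nondegenerate (trans (sym (neg-involutive _)) (cong -_ (trans (sym (orient-swap P Q R)) e)))) ,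
    λ X inside → relabel (empty X (sameSign-flip
      (sameSign-cong (orient-reverse R P X) (orient-reverse Q R X) (orient-reverse P Q X) inside)))
    where
    relabel : ∀ {X} → X ≡ P ⊎ X ≡ Q ⊎ X ≡ R → X ≡ P ⊎ X ≡ R ⊎ X ≡ Q
    relabel (inj₁ e)        = inj₁ e
    relabel (inj₂ (inj₁ e)) = inj₂ (inj₂ e)
    relabel (inj₂ (inj₂ e)) = inj₂ (inj₁ e)

  minimal-image : (f : Point → Point) → (∀ X → f (f X) ≡ X) →
    (∀ A B C → orient (f A) (f B) (f C) ≡ orient A B C) →
    ∀ {P Q R} → Minimal (tri P Q R) → Minimal (tri (f P) (f Q) (f R))
  minimal-image f involutive preserves {P} {Q} {R} (nondegenerate , empty) =
    (λ e → nondegenerate (trans (sym (preserves P Q R)) e)) ,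
    λ X inside → back (empty (f X) (sameSign-cong (moved P Q X) (moved Q R X) (moved R P X) inside))
    where
    moved : ∀ A B X → orient (f A) (f B) X ≡ orient A B (f X)
    moved A B X = trans (cong (orient (f A) (f B)) (sym (involutive X))) (preserves A B (f X))
    back : ∀ {X} → f X ≡ P ⊎ f X ≡ Q ⊎ f X ≡ R → X ≡ f P ⊎ X ≡ f Q ⊎ X ≡ f R
    back {X} (inj₁ e)        = inj₁ (trans (sym (involutive X)) (cong f e))
    back {X} (inj₂ (inj₁ e)) = inj₂ (inj₁ (trans (sym (involutive X)) (cong f e)))
    back {X} (inj₂ (inj₂ e)) = inj₂ (inj₂ (trans (sym (involutive X)) (cong f e)))

  -- The triangle P R S completing P Q R to a parallelogram is its point reflection,
  -- so it is again minimal and has the same orientation.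
  minimal-fourth : ∀ {P Q R} → Minimal (tri P Q R) → Minimal (tri P R (fourth P Q R))
  minimal-fourth {P} {Q} {R} minimal = minimal-rotate (minimal-rotate reflected)
    where
    reflected : Minimal (tri R (fourth P Q R) P)
    reflected = subst₂ (λ A C → Minimal (tri A (fourth P Q R) C)) (reflect-left P R) (reflect-right P R)
      (minimal-image (reflect (P ⊕ R)) (reflect-involutive (P ⊕ R)) (orient-reflect (P ⊕ R)) minimal)

  orient-fourth : ∀ P Q R → orient P R (fourth P Q R) ≡ orient P Q R
  orient-fourth P Q R = begin
    orient P R S                ≡⟨ orient-rotate P R S ⟨
    orient R S P                ≡⟨ cong₂ (λ A C → orient A S C) (reflect-left P R) (reflect-right P R) ⟨
    orient (f P) (f Q) (f R)    ≡⟨ orient-reflect (P ⊕ R) P Q R ⟩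
    orient P Q R                ∎
    where
    open ≡-Reasoning
    S = fourth P Q R
    f = reflect (P ⊕ R)

  parallelogram-fourth : ∀ P Q R S → P ⊖ Q ≡ S ⊖ R → S ≡ fourth P Q R
  parallelogram-fourth (p₁ , p₂) (q₁ , q₂) (r₁ , r₂) (s₁ , s₂) e =
    cong₂ _,_ (solve-for p₁ q₁ r₁ s₁ (cong proj₁ e)) (solve-for p₂ q₂ r₂ s₂ (cong proj₂ e))
    where
    solve-for : ∀ p q r s → p - q ≡ s - r → s ≡ (p + r) - q
    solve-for p q r s e = trans (split s r) (trans (cong (_+ r) (sym e)) (regroup p q r))
      where
      split : ∀ s r → s ≡ (s - r) + r
      split = solve-∀
      regroup : ∀ p q r → (p - q) + r ≡ (p + r) - q
      regroup = solve-∀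

  fourth-parallelogram : ∀ P Q R → P ⊖ Q ≡ fourth P Q R ⊖ R
  fourth-parallelogram (p₁ , p₂) (q₁ , q₂) (r₁ , r₂) = cong₂ _,_ (identity p₁ q₁ r₁) (identity p₂ q₂ r₂)
    where
    identity : ∀ p q r → p - q ≡ ((p + r) - q) - r
    identity = solve-∀

  fourth-symmetric : ∀ P Q R → fourth R Q P ≡ fourth P Q R
  fourth-symmetric (p₁ , p₂) Q (r₁ , r₂) = cong (λ c → reflect c Q) (cong₂ _,_ (+-comm r₁ p₁) (+-comm r₂ p₂))

  det-antisymmetric : ∀ P R → det R P + det P R ≡ 0ℤ
  det-antisymmetric (p₁ , p₂) (r₁ , r₂) = identity p₁ p₂ r₁ r₂
    where
    identity : ∀ p₁ p₂ r₁ r₂ → (r₁ * p₂ - p₁ * r₂) + (p₁ * r₂ - r₁ * p₂) ≡ 0ℤ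
    identity = solve-∀

  det-opposite₁ : ∀ P Q R → det P Q + det R (fourth P Q R) ≡ orient P Q R
  det-opposite₁ (p₁ , p₂) (q₁ , q₂) (r₁ , r₂) = identity p₁ p₂ q₁ q₂ r₁ r₂
    where
    identity : ∀ p₁ p₂ q₁ q₂ r₁ r₂ →
      (p₁ * q₂ - q₁ * p₂) + (r₁ * ((p₂ + r₂) - q₂) - ((p₁ + r₁) - q₁) * r₂)
        ≡ (q₁ - p₁) * (r₂ - p₂) - (r₁ - p₁) * (q₂ - p₂)
    identity = solve-∀

  det-opposite₂ : ∀ P Q R → det Q R + det (fourth P Q R) P ≡ orient P Q R
  det-opposite₂ (p₁ , p₂) (q₁ , q₂) (r₁ , r₂) = identity p₁ p₂ q₁ q₂ r₁ r₂
    where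
    identity : ∀ p₁ p₂ q₁ q₂ r₁ r₂ →
      (q₁ * r₂ - r₁ * q₂) + (((p₁ + r₁) - q₁) * p₂ - p₁ * ((p₂ + r₂) - q₂))
        ≡ (q₁ - p₁) * (r₂ - p₂) - (r₁ - p₁) * (q₂ - p₂)
    identity = solve-∀

module Residues (d : ℕ) .{{_ : NonZero d}} where

  open import Data.Nat as ℕ using (_%_; _<_; zero; suc)
  import Data.Nat.Properties as ℕ
  open import Data.Nat.DivMod using (m<n⇒m%n≡m; m*n%n≡0)
  import Data.Nat.Divisibility as ℕ
  open import Data.Integer as ℤ using (ℤ; +_; -_; _-_; _*_; _%ℕ_; _/ℕ_; ∣_∣)
  open import Data.Integer.Properties
    using (pos-+; +-injective; +-identityʳ; ∣i∣≡0⇒i≡0; i-j≡0⇒i≡j; [+m]-[+n]≡m⊖n; ∣m⊝n∣≤m⊔n)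
  open import Data.Integer.DivMod using (n%ℕd<d; a≡a%ℕn+[a/ℕn]*n)
  open import Data.Integer.Divisibility.Signed
    using (_∣_; divides; ∣m∣n⇒∣m+n; ∣m∣n⇒∣m-n; ∣m⇒∣-m; ∣⇒∣ᵤ)
  open import Data.Integer.Tactic.RingSolver using (solve-∀)
  open import Data.Empty using (⊥-elim)
  open import Relation.Binary.PropositionalEquality
    using (_≡_; refl; sym; trans; cong; cong₂; subst; module ≡-Reasoning)

  remainder-equation : ∀ a → a - (a /ℕ d) * + d ≡ + (a %ℕ d)
  remainder-equation a = solve-for (a≡a%ℕn+[a/ℕn]*n a d)
    where
    solve-for : ∀ {a r t} → a ≡ r ℤ.+ t → a - t ≡ r
    solve-for {r = r} {t} refl = identity r t
      where
      identity : ∀ r t → r ℤ.+ t - t ≡ r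
      identity = solve-∀

  residue-congruent : ∀ a → + d ∣ a - + (a %ℕ d)
  residue-congruent a = divides (a /ℕ d) (solve-for (a≡a%ℕn+[a/ℕn]*n a d))
    where
    solve-for : ∀ {a r t} → a ≡ r ℤ.+ t → a - r ≡ t
    solve-for {r = r} {t} refl = identity r t
      where
      identity : ∀ r t → r ℤ.+ t - r ≡ t
      identity = solve-∀

  zero-remainder⇒divisible : ∀ a → a %ℕ d ≡ 0 → + d ∣ a
  zero-remainder⇒divisible a a%d≡0 =
    subst (+ d ∣_) (+-identityʳ a) (subst (λ r → + d ∣ a - + r) a%d≡0 (residue-congruent a))

  multiple-below : ∀ {n} → d ℕ.∣ n → n < d → n ≡ 0
  multiple-below {zero}  _   _   = refl
  multiple-below {suc n} d∣n n<d = ⊥-elim (ℕ.<⇒≱ n<d (ℕ.∣⇒≤ d∣n))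

  congruent⇒same-residue : ∀ a b → + d ∣ a - b → a %ℕ d ≡ b %ℕ d
  congruent⇒same-residue a b d∣a-b = +-injective (i-j≡0⇒i≡j _ _ difference≡0)
    where
    ra = a %ℕ d
    rb = b %ℕ d
    regroup : + ra - + rb ≡ (a - b) - (a - + ra) ℤ.+ (b - + rb)
    regroup = identity a b (+ ra) (+ rb)
      where
      identity : ∀ a b r s → r - s ≡ (a - b) - (a - r) ℤ.+ (b - s)
      identity = solve-∀
    d∣difference : + d ∣ + ra - + rb
    d∣difference = subst (+ d ∣_) (sym regroup)
      (∣m∣n⇒∣m+n (∣m∣n⇒∣m-n d∣a-b (residue-congruent a)) (residue-congruent b))
    distance<d : ∣ ra ℤ.⊖ rb ∣ < d
    distance<d = ℕ.≤-<-trans (∣m⊝n∣≤m⊔n ra rb) (ℕ.⊔-lub (n%ℕd<d a d) (n%ℕd<d b d))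
    difference≡0 : + ra - + rb ≡ + 0
    difference≡0 = trans ([+m]-[+n]≡m⊖n ra rb) (∣i∣≡0⇒i≡0 (multiple-below
      (subst (d ℕ.∣_) (cong ∣_∣ ([+m]-[+n]≡m⊖n ra rb)) (∣⇒∣ᵤ d∣difference)) distance<d))

  same-residue⇒congruent : ∀ a b → a %ℕ d ≡ b %ℕ d → + d ∣ a - b
  same-residue⇒congruent a b same = subst (+ d ∣_) (identity a b (+ (b %ℕ d)))
    (∣m∣n⇒∣m-n (subst (λ r → + d ∣ a - + r) same (residue-congruent a)) (residue-congruent b))
    where
    identity : ∀ a b r → (a - r) - (b - r) ≡ a - b
    identity = solve-∀

  residue-+ : ∀ a b → (a %ℕ d ℕ.+ b %ℕ d) % d ≡ (a ℤ.+ b) %ℕ d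
  residue-+ a b = congruent⇒same-residue (+ (a %ℕ d ℕ.+ b %ℕ d)) (a ℤ.+ b) (subst (+ d ∣_) (sym regroup)
    (∣m⇒∣-m (∣m∣n⇒∣m+n (residue-congruent a) (residue-congruent b))))
    where
    ra = a %ℕ d
    rb = b %ℕ d
    regroup : + (ra ℕ.+ rb) - (a ℤ.+ b) ≡ - ((a - + ra) ℤ.+ (b - + rb))
    regroup = trans (cong (_- (a ℤ.+ b)) (pos-+ ra rb)) (identity a b (+ ra) (+ rb))
      where
      identity : ∀ a b r s → (r ℤ.+ s) - (a ℤ.+ b) ≡ - ((a - r) ℤ.+ (b - s))
      identity = solve-∀

  residue-cancelˡ : ∀ u {x y} → x < d → y < d → (u ℕ.+ x) % d ≡ (u ℕ.+ y) % d → x ≡ y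
  residue-cancelˡ u {x} {y} x<d y<d same = begin
    x       ≡⟨ m<n⇒m%n≡m x<d ⟨
    x % d   ≡⟨ congruent⇒same-residue (+ x) (+ y)
                 (subst (+ d ∣_) (shift u x y) (same-residue⇒congruent (+ (u ℕ.+ x)) (+ (u ℕ.+ y)) same)) ⟩
    y % d   ≡⟨ m<n⇒m%n≡m y<d ⟩
    y       ∎
    where
    open ≡-Reasoning
    shift : ∀ u x y → + (u ℕ.+ x) - + (u ℕ.+ y) ≡ + x - + y
    shift u x y = trans (cong₂ _-_ (pos-+ u x) (pos-+ u y)) (identity (+ u) (+ x) (+ y))
      where
      identity : ∀ u x y → (u ℤ.+ x) - (u ℤ.+ y) ≡ x - y
      identity = solve-∀

  zero-residue : 0 % d ≡ 0
  zero-residue = m*n%n≡0 0 d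

module ThreeElementPermutations {A : Set} where

  open import Data.List using ([]; _∷_; [_])
  open import Data.List.Relation.Unary.Any using (here; there)
  open import Data.List.Relation.Binary.Permutation.Propositional using (_↭_; ↭-sym)
  open import Data.List.Relation.Binary.Permutation.Propositional.Properties
    using (∈-resp-↭; drop-mid; ↭-singleton-inv; shift)
  open import Data.Product using (_×_; _,_)
  open import Data.Sum using (_⊎_; inj₁; inj₂)
  open import Relation.Binary.PropositionalEquality using (_≡_; refl)

  ↭-head : ∀ {a b c x : A} {ys} → a ∷ b ∷ c ∷ [] ↭ x ∷ ys →
    (x ≡ a × b ∷ c ∷ [] ↭ ys) ⊎ (x ≡ b × a ∷ c ∷ [] ↭ ys) ⊎ (x ≡ c × a ∷ b ∷ [] ↭ ys)
  ↭-head {a} {b} p with ∈-resp-↭ (↭-sym p) (here refl)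
  ... | here refl                 = inj₁ (refl , drop-mid [] [] p)
  ... | there (here refl)         = inj₂ (inj₁ (refl , drop-mid [ a ] [] p))
  ... | there (there (here refl)) = inj₂ (inj₂ (refl , drop-mid (a ∷ b ∷ []) [] p))

  ↭-singleton : ∀ {u v : A} → [ u ] ↭ [ v ] → v ≡ u
  ↭-singleton q with ↭-singleton-inv (↭-sym q)
  ... | refl = refl

  ↭-pair : ∀ {a b x y : A} → a ∷ b ∷ [] ↭ x ∷ y ∷ [] → (x ≡ a × y ≡ b) ⊎ (x ≡ b × y ≡ a)
  ↭-pair {a} p with ∈-resp-↭ (↭-sym p) (here refl)
  ... | here refl         = inj₁ (refl , ↭-singleton (drop-mid [] [] p))
  ... | there (here refl) = inj₂ (refl , ↭-singleton (drop-mid [ a ] [] p))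

  ↭-rotate : ∀ (a b c : A) → a ∷ b ∷ c ∷ [] ↭ b ∷ c ∷ a ∷ []
  ↭-rotate a b c = ↭-sym (shift a (b ∷ c ∷ []) [])

module Unimodularity where

  open Geometry
  open import Data.Nat as ℕ using (zero; suc; _<_; _≤_; _∸_; z≤n; s≤s; _≤?_)
  import Data.Nat.Properties as ℕ
  import Data.Nat.Divisibility as ℕ
  open import Data.Integer as ℤ
    using (ℤ; +_; -[1+_]; -_; _-_; _*_; _%ℕ_; _/ℕ_; 0ℤ; 1ℤ; -1ℤ; +≤+)
  open import Data.Integer.Properties
    using (+-injective; *-identityʳ; pos-+; [+m]-[+n]≡m⊖n; ⊖-≥)
  open import Data.Integer.DivMod using (n%ℕd<d)
  open import Data.Integer.Divisibility.Signed
    using (_∣_; divides; ∣m∣n⇒∣m-n; *-cancelˡ-∣; ∣⇒∣ᵤ)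
  open import Data.Integer.Tactic.RingSolver using (solve-∀)
  open import Data.Product using (_×_; _,_; proj₁; proj₂; ∃-syntax)
  open import Data.Sum using (_⊎_; inj₁; inj₂)
  open import Data.Empty using (⊥; ⊥-elim)
  open import Relation.Nullary using (¬_; yes; no)
  open import Relation.Binary.PropositionalEquality
    using (_≡_; refl; sym; trans; cong; cong₂; subst; module ≡-Reasoning)

  _·_ : ℤ → Point → Point
  m · (x , y) = (m * x , m * y)

  orient-sum : ∀ P Q R X → orient Q R X ≡ orient P Q R - orient P Q X - orient R P X
  orient-sum (p₁ , p₂) (q₁ , q₂) (r₁ , r₂) (x₁ , x₂) = identity p₁ p₂ q₁ q₂ r₁ r₂ x₁ x₂
    where
    identity : ∀ p₁ p₂ q₁ q₂ r₁ r₂ x₁ x₂ →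
      (r₁ - q₁) * (x₂ - q₂) - (x₁ - q₁) * (r₂ - q₂)
        ≡ (q₁ - p₁) * (r₂ - p₂) - (r₁ - p₁) * (q₂ - p₂)
          - ((q₁ - p₁) * (x₂ - p₂) - (x₁ - p₁) * (q₂ - p₂))
          - ((p₁ - r₁) * (x₂ - r₂) - (x₁ - r₁) * (p₂ - r₂))
    identity = solve-∀

  sublattice-shift : ∀ P Q R E m n → let X = E ⊖ ((m · (Q ⊖ P)) ⊕ (n · (R ⊖ P))) in
    orient R P X ≡ orient R P E - m * orient P Q R × orient P Q X ≡ orient P Q E - n * orient P Q R
  sublattice-shift (p₁ , p₂) (q₁ , q₂) (r₁ , r₂) (e₁ , e₂) m n =
    identity₁ p₁ p₂ q₁ q₂ r₁ r₂ e₁ e₂ m n , identity₂ p₁ p₂ q₁ q₂ r₁ r₂ e₁ e₂ m n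
    where
    identity₁ : ∀ p₁ p₂ q₁ q₂ r₁ r₂ e₁ e₂ m n →
      (p₁ - r₁) * ((e₂ - (m * (q₂ - p₂) ℤ.+ n * (r₂ - p₂))) - r₂)
        - ((e₁ - (m * (q₁ - p₁) ℤ.+ n * (r₁ - p₁))) - r₁) * (p₂ - r₂)
        ≡ (p₁ - r₁) * (e₂ - r₂) - (e₁ - r₁) * (p₂ - r₂) - m * ((q₁ - p₁) * (r₂ - p₂) - (r₁ - p₁) * (q₂ - p₂))
    identity₁ = solve-∀
    identity₂ : ∀ p₁ p₂ q₁ q₂ r₁ r₂ e₁ e₂ m n →
      (q₁ - p₁) * ((e₂ - (m * (q₂ - p₂) ℤ.+ n * (r₂ - p₂))) - p₂)
        - ((e₁ - (m * (q₁ - p₁) ℤ.+ n * (r₁ - p₁))) - p₁) * (q₂ - p₂)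
        ≡ (q₁ - p₁) * (e₂ - p₂) - (e₁ - p₁) * (q₂ - p₂) - n * ((q₁ - p₁) * (r₂ - p₂) - (r₁ - p₁) * (q₂ - p₂))
    identity₂ = solve-∀

  reflect-coordinates : ∀ P Q R X → let X′ = reflect (Q ⊕ R) X in
    orient R P X′ ≡ orient P Q R - orient R P X × orient P Q X′ ≡ orient P Q R - orient P Q X
  reflect-coordinates (p₁ , p₂) (q₁ , q₂) (r₁ , r₂) (x₁ , x₂) =
    identity₁ p₁ p₂ q₁ q₂ r₁ r₂ x₁ x₂ , identity₂ p₁ p₂ q₁ q₂ r₁ r₂ x₁ x₂
    where
    identity₁ : ∀ p₁ p₂ q₁ q₂ r₁ r₂ x₁ x₂ →
      (p₁ - r₁) * (((q₂ ℤ.+ r₂) - x₂) - r₂) - (((q₁ ℤ.+ r₁) - x₁) - r₁) * (p₂ - r₂)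
        ≡ (q₁ - p₁) * (r₂ - p₂) - (r₁ - p₁) * (q₂ - p₂) - ((p₁ - r₁) * (x₂ - r₂) - (x₁ - r₁) * (p₂ - r₂))
    identity₁ = solve-∀
    identity₂ : ∀ p₁ p₂ q₁ q₂ r₁ r₂ x₁ x₂ →
      (q₁ - p₁) * (((q₂ ℤ.+ r₂) - x₂) - p₂) - (((q₁ ℤ.+ r₁) - x₁) - p₁) * (q₂ - p₂)
        ≡ (q₁ - p₁) * (r₂ - p₂) - (r₁ - p₁) * (q₂ - p₂) - ((q₁ - p₁) * (x₂ - p₂) - (x₁ - p₁) * (q₂ - p₂))
    identity₂ = solve-∀

  -- The coordinates of the unit points P + e₁, P + e₂ recover the area (Cramer's rule).
  unit-points : ∀ P Q R → let E₁ = P ⊕ (+ 1 , 0ℤ); E₂ = P ⊕ (0ℤ , + 1) in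
    orient P Q R ≡ orient P Q E₂ * orient R P E₁ - orient R P E₂ * orient P Q E₁
  unit-points (p₁ , p₂) (q₁ , q₂) (r₁ , r₂) = identity p₁ p₂ q₁ q₂ r₁ r₂
    where
    identity : ∀ p₁ p₂ q₁ q₂ r₁ r₂ →
      (q₁ - p₁) * (r₂ - p₂) - (r₁ - p₁) * (q₂ - p₂)
        ≡ ((q₁ - p₁) * ((p₂ ℤ.+ + 1) - p₂) - ((p₁ ℤ.+ 0ℤ) - p₁) * (q₂ - p₂))
          * ((p₁ - r₁) * ((p₂ ℤ.+ 0ℤ) - r₂) - ((p₁ ℤ.+ + 1) - r₁) * (p₂ - r₂))
          - ((p₁ - r₁) * ((p₂ ℤ.+ + 1) - r₂) - ((p₁ ℤ.+ 0ℤ) - r₁) * (p₂ - r₂))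
          * ((q₁ - p₁) * ((p₂ ℤ.+ 0ℤ) - p₂) - ((p₁ ℤ.+ + 1) - p₁) * (q₂ - p₂))
    identity = solve-∀

  -- Lattice points of a triangle of area k = orient P Q R > 0, described by their three
  -- coordinates orient Q R X, orient R P X, orient P Q X (barycentric coordinates scaled by k).
  module LargeArea {P Q R : Point} (k : ℕ) .{{_ : NonZero k}} (area : orient P Q R ≡ + k) where

    open Residues k using (remainder-equation; zero-remainder⇒divisible)

    Below : ℤ → Set
    Below z = ∃[ n ] (z ≡ + n × n < k)

    below-difference : ∀ {m n} → n ≤ m → m < n ℕ.+ k → Below (+ m - + n)
    below-difference {m} {n} n≤m m<n+k =
      m ∸ n , trans ([+m]-[+n]≡m⊖n m n) (⊖-≥ n≤m) , ℕ.m<n+o⇒m∸n<o m n m<n+k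

    below-nonnegative : ∀ {z} → Below z → 0ℤ ℤ.≤ z
    below-nonnegative (_ , refl , _) = +≤+ z≤n

    below-area : ∀ {z} → Below z → z ≡ + k → ⊥
    below-area (n , z≡n , n<k) z≡k = ℕ.<-irrefl (+-injective (trans (sym z≡n) z≡k)) n<k

    -- A point whose three coordinates lie in [0, k) is inside the triangle, yet it is
    -- no vertex, since each vertex has one coordinate equal to k.
    inner-point : Minimal (tri P Q R) → ∀ X →
      Below (orient Q R X) → Below (orient R P X) → Below (orient P Q X) → ⊥
    inner-point (_ , empty) X α β γ
      with empty X (inj₁ (below-nonnegative γ , below-nonnegative α , below-nonnegative β))
    ... | inj₁ refl        = below-area α (trans (orient-rotate P Q R) area)
    ... | inj₂ (inj₁ refl) = below-area β (trans (orient-rotate Q R P) (trans (orient-rotate P Q R) area))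
    ... | inj₂ (inj₂ refl) = below-area γ area

    -- Every point is congruent, modulo the lattice spanned by the sides, to a point whose
    -- coordinates at Q and R are the remainders of those of E.
    reduce : ∀ E → ∃[ X ] (orient R P X ≡ + (orient R P E %ℕ k) × orient P Q X ≡ + (orient P Q E %ℕ k))
    reduce E = E ⊖ ((m · (Q ⊖ P)) ⊕ (n · (R ⊖ P))) ,
               reduced (orient R P E) (proj₁ shifted) , reduced (orient P Q E) (proj₂ shifted)
      where
      m = orient R P E /ℕ k
      n = orient P Q E /ℕ k
      shifted = sublattice-shift P Q R E m n
      reduced : ∀ z {x} → x ≡ z - (z /ℕ k) * orient P Q R → x ≡ + (z %ℕ k)
      reduced z x≡ = begin
        _                        ≡⟨ x≡ ⟩
        z - (z /ℕ k) * orient P Q R ≡⟨ cong (λ a → z - (z /ℕ k) * a) area ⟩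
        z - (z /ℕ k) * + k       ≡⟨ remainder-equation z ⟩
        + (z %ℕ k)               ∎
        where open ≡-Reasoning

    third-coordinate : ∀ X {a b} → orient R P X ≡ a → orient P Q X ≡ b → orient Q R X ≡ + k - b - a
    third-coordinate X refl refl = trans (orient-sum P Q R X) (cong (λ c → c - orient P Q X - orient R P X) area)

    -- If a point X has coordinates r, s ∈ [0, k) at Q and R, not both zero, then X (when
    -- r + s ≤ k) or its reflection through the midpoint of Q R (when r + s > k) has all
    -- three coordinates in [0, k).
    nonzero-coordinates : Minimal (tri P Q R) → ∀ X {r s} → orient R P X ≡ + r → orient P Q X ≡ + s →
      r < k → s < k → 0 < r ℕ.+ s → ⊥
    nonzero-coordinates minimal X {r} {s} Xr Xs r<k s<k 0<r+s with r ℕ.+ s ≤? k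
    ... | yes r+s≤k =
      inner-point minimal X
        (subst Below (sym (trans (third-coordinate X Xr Xs) (small (+ k) r s)))
          (below-difference r+s≤k (ℕ.m<n+m k 0<r+s)))
        (r , Xr , r<k) (s , Xs , s<k)
      where
      small : ∀ k r s → k - + s - + r ≡ k - + (r ℕ.+ s)
      small k r s = trans (identity k (+ r) (+ s)) (cong (_-_ k) (sym (pos-+ r s)))
        where
        identity : ∀ k r s → k - s - r ≡ k - (r ℤ.+ s)
        identity = solve-∀
    ... | no r+s≰k =
      inner-point minimal X′
        (subst Below (sym (trans (third-coordinate X′ X′r X′s) (large (+ k) r s)))
          (below-difference (ℕ.<⇒≤ k<r+s) (ℕ.+-mono-< r<k s<k)))
        (subst Below (sym X′r) (below-difference (ℕ.<⇒≤ r<k)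
          (ℕ.<-≤-trans k<r+s (ℕ.+-monoʳ-≤ r (ℕ.<⇒≤ s<k)))))
        (subst Below (sym X′s) (below-difference (ℕ.<⇒≤ s<k)
          (subst (k <_) (ℕ.+-comm k s) (ℕ.<-≤-trans k<r+s (ℕ.+-monoˡ-≤ s (ℕ.<⇒≤ r<k))))))
      where
      k<r+s = ℕ.≰⇒> r+s≰k
      X′ = reflect (Q ⊕ R) X
      X′r : orient R P X′ ≡ + k - + r
      X′r = trans (proj₁ (reflect-coordinates P Q R X)) (cong₂ _-_ area Xr)
      X′s : orient P Q X′ ≡ + k - + s
      X′s = trans (proj₂ (reflect-coordinates P Q R X)) (cong₂ _-_ area Xs)
      large : ∀ k r s → k - (k - + s) - (k - + r) ≡ + (r ℕ.+ s) - k
      large k r s = trans (identity k (+ r) (+ s)) (cong (_- k) (sym (pos-+ r s)))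
        where
        identity : ∀ k r s → k - (k - s) - (k - r) ≡ (r ℤ.+ s) - k
        identity = solve-∀

    nonzero-remainders : Minimal (tri P Q R) → ∀ E → 0 < orient R P E %ℕ k ℕ.+ orient P Q E %ℕ k → ⊥
    nonzero-remainders minimal E 0<r+s =
      let X , Xr , Xs = reduce E in
      nonzero-coordinates minimal X Xr Xs (n%ℕd<d (orient R P E) k) (n%ℕd<d (orient P Q E) k) 0<r+s

    remainders : ∀ E → 0 < orient R P E %ℕ k ℕ.+ orient P Q E %ℕ k ⊎ (+ k ∣ orient R P E × + k ∣ orient P Q E)
    remainders E with orient R P E %ℕ k in r≡0 | orient P Q E %ℕ k in s≡0
    ... | suc _ | _     = inj₁ (s≤s z≤n)
    ... | zero  | suc _ = inj₁ (s≤s z≤n)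
    ... | zero  | zero  = inj₂ (zero-remainder⇒divisible _ r≡0 , zero-remainder⇒divisible _ s≡0)

    square-divides : ∀ {a b} → + k ∣ a → + k ∣ b → + k * + k ∣ a * b
    square-divides (divides m refl) (divides n refl) = divides (m * n) (identity m n (+ k))
      where
      identity : ∀ m n k → (m * k) * (n * k) ≡ (m * n) * (k * k)
      identity = solve-∀

    -- If k divides the coordinates of both unit points, then k² divides k, so k = 1.
    unit-points-divisible : let E₁ = P ⊕ (+ 1 , 0ℤ); E₂ = P ⊕ (0ℤ , + 1) in
      + k ∣ orient R P E₁ × + k ∣ orient P Q E₁ → + k ∣ orient R P E₂ × + k ∣ orient P Q E₂ → k ≡ 1
    unit-points-divisible (r₁ , s₁) (r₂ , s₂) = ℕ.∣1⇒≡1 (∣⇒∣ᵤ (*-cancelˡ-∣ (+ k) k²∣k))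
      where
      k²∣k : + k * + k ∣ + k * + 1
      k²∣k = subst (+ k * + k ∣_) (trans (sym (unit-points P Q R)) (trans area (sym (*-identityʳ (+ k)))))
        (∣m∣n⇒∣m-n (square-divides s₂ r₁) (square-divides r₂ s₁))

    not-minimal : 2 ≤ k → ¬ Minimal (tri P Q R)
    not-minimal 2≤k minimal with remainders (P ⊕ (+ 1 , 0ℤ)) | remainders (P ⊕ (0ℤ , + 1))
    ... | inj₁ nonzero₁ | _              = nonzero-remainders minimal (P ⊕ (+ 1 , 0ℤ)) nonzero₁
    ... | inj₂ _        | inj₁ nonzero₂  = nonzero-remainders minimal (P ⊕ (0ℤ , + 1)) nonzero₂
    ... | inj₂ divisible₁ | inj₂ divisible₂ = ℕ.<⇒≢ 2≤k (sym (unit-points-divisible divisible₁ divisible₂))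

  minimal⇒unimodular : ∀ {P Q R} → Minimal (tri P Q R) → orient P Q R ≡ 1ℤ ⊎ orient P Q R ≡ -1ℤ
  minimal⇒unimodular {P} {Q} {R} minimal = classify (orient P Q R) refl
    where
    classify : ∀ a → orient P Q R ≡ a → orient P Q R ≡ 1ℤ ⊎ orient P Q R ≡ -1ℤ
    classify (+ 0)           area = ⊥-elim (proj₁ minimal area)
    classify (+ 1)           area = inj₁ area
    classify (+ suc (suc k)) area = ⊥-elim (LargeArea.not-minimal (suc (suc k)) area (s≤s (s≤s z≤n)) minimal)
    classify -[1+ 0 ]        area = inj₂ area
    classify -[1+ suc k ]    area = ⊥-elim (LargeArea.not-minimal (suc (suc k))
      (trans (orient-swap P Q R) (cong -_ area)) (s≤s (s≤s z≤n)) (minimal-swap minimal))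

module Weights (d : ℕ) .{{_ : NonZero d}} where

  open Geometry
  open ThreeElementPermutations using (↭-head; ↭-pair; ↭-rotate)
  open import Data.Nat using (_<_)
  open import Data.Integer as ℤ using (0ℤ)
  open import Data.Integer.Properties using (<-asym; ≤∧≢⇒<; ≮⇒≥; neg-mono-<)
  open import Data.Integer.DivMod using (n%ℕd<d)
  open import Data.List.Relation.Unary.All using (All; []; _∷_)
  open import Data.List.Relation.Binary.Permutation.Propositional using (↭-sym; ↭-trans; ↭-reflexive)
  open import Data.Product using (_,_; proj₁)
  open import Data.Sum using (inj₁; inj₂)
  open import Relation.Nullary using (¬_; yes; no)
  open import Relation.Binary.PropositionalEquality using (refl; sym; subst)
  open import Data.Empty using (⊥-elim)

  w : Point → Point → ℕ
  w = edgeWeight d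

  edgeWeights : Point → Point → Point → List ℕ
  edgeWeights P Q R = w P Q ∷ w Q R ∷ w R P ∷ []

  weight-positive : ∀ P Q R → 0ℤ ℤ.< orient P Q R → weight d (tri P Q R) ≡ edgeWeights P Q R
  weight-positive P Q R positive with 0ℤ ℤ.<? orient P Q R
  ... | yes _          = refl
  ... | no notPositive = ⊥-elim (notPositive positive)

  weight-negative : ∀ P Q R → ¬ 0ℤ ℤ.< orient P Q R → weight d (tri P Q R) ≡ edgeWeights P R Q
  weight-negative P Q R notPositive with 0ℤ ℤ.<? orient P Q R
  ... | yes positive = ⊥-elim (notPositive positive)
  ... | no _         = refl

  weight-rotate : ∀ P Q R → weight d (tri P Q R) ↭ weight d (tri Q R P)
  weight-rotate P Q R with 0ℤ ℤ.<? orient P Q R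
  ... | yes positive = subst (edgeWeights P Q R ↭_) (sym (weight-positive Q R P rotated)) (↭-rotate _ _ _)
    where
    rotated : 0ℤ ℤ.< orient Q R P
    rotated = subst (0ℤ ℤ.<_) (sym (orient-rotate P Q R)) positive
  ... | no notPositive = subst (edgeWeights P R Q ↭_) (sym (weight-negative Q R P rotated)) (↭-sym (↭-rotate _ _ _))
    where
    rotated : ¬ 0ℤ ℤ.< orient Q R P
    rotated = λ positive → notPositive (subst (0ℤ ℤ.<_) (orient-rotate P Q R) positive)

  weight-swap : ∀ P Q R → NonDegenerate (tri P Q R) → weight d (tri P Q R) ↭ weight d (tri P R Q)
  weight-swap P Q R nondegenerate with 0ℤ ℤ.<? orient P Q R
  ... | yes positive   = ↭-reflexive (sym (weight-negative P R Q swapped))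
    where
    swapped : ¬ 0ℤ ℤ.< orient P R Q
    swapped positive′ = <-asym (subst (0ℤ ℤ.<_) (orient-swap P Q R) positive′) (neg-mono-< positive)
  ... | no notPositive = ↭-reflexive (sym (weight-positive P R Q swapped))
    where
    swapped : 0ℤ ℤ.< orient P R Q
    swapped = subst (0ℤ ℤ.<_) (sym (orient-swap P Q R)) (neg-mono-< (≤∧≢⇒< (≮⇒≥ notPositive) nondegenerate))

  weight-below : ∀ A B → w A B < d
  weight-below A B = n%ℕd<d (det A B) d

  weight-bounded : ∀ T → All (_< d) (weight d T)
  weight-bounded (tri P Q R) with 0ℤ ℤ.<? orient P Q R
  ... | yes _ = weight-below P Q ∷ weight-below Q R ∷ weight-below R P ∷ []
  ... | no _  = weight-below P R ∷ weight-below R Q ∷ weight-below Q P ∷ []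

  MinimalOfWeight : List ℕ → Triangle → Set
  MinimalOfWeight ω T = Minimal T × weight d T ↭ ω

  rotate : ∀ {ω P Q R} → MinimalOfWeight ω (tri P Q R) → MinimalOfWeight ω (tri Q R P)
  rotate {P = P} {Q} {R} (minimal , weighted) =
    minimal-rotate minimal , ↭-trans (↭-sym (weight-rotate P Q R)) weighted

  swap : ∀ {ω P Q R} → MinimalOfWeight ω (tri P Q R) → MinimalOfWeight ω (tri P R Q)
  swap {P = P} {Q} {R} (minimal , weighted) =
    minimal-swap minimal , ↭-trans (↭-sym (weight-swap P Q R (proj₁ minimal))) weighted

  relabel-tail : ∀ {ω P B C Q R} → B ∷ C ∷ [] ↭ Q ∷ R ∷ [] →
    MinimalOfWeight ω (tri P B C) → MinimalOfWeight ω (tri P Q R)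
  relabel-tail p t with ↭-pair p
  ... | inj₁ (refl , refl) = t
  ... | inj₂ (refl , refl) = swap t

  relabel : ∀ {ω A B C P Q R} → A ∷ B ∷ C ∷ [] ↭ P ∷ Q ∷ R ∷ [] →
    MinimalOfWeight ω (tri A B C) → MinimalOfWeight ω (tri P Q R)
  relabel p t with ↭-head p
  ... | inj₁ (refl , rest)        = relabel-tail rest t
  ... | inj₂ (inj₁ (refl , rest)) = relabel-tail rest (rotate (rotate (swap t)))
  ... | inj₂ (inj₂ (refl , rest)) = relabel-tail rest (rotate (rotate t))

module Flips (d : ℕ) .{{_ : NonZero d}} where

  open Geometry
  open Unimodularity using (minimal⇒unimodular)
  open Residues d using (residue-+; residue-cancelˡ; zero-residue)
  open Weights d
  open ThreeElementPermutations using (↭-head; ↭-pair; ↭-rotate)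
  open import Data.Nat using (_<_; _+_; _%_; z≤n; s≤s)
  open import Data.Integer as ℤ using (0ℤ; 1ℤ; -_; _%ℕ_; +<+)
  open import Data.List.Relation.Unary.All as All using (All)
  open import Data.List.Relation.Binary.Permutation.Propositional
    using (↭-refl; ↭-sym; ↭-trans; ↭-prep; ↭-swap; ↭-reflexive)
  open import Data.List.Relation.Binary.Permutation.Propositional.Properties using (All-resp-↭)
  open import Data.Product using (_,_; proj₁; proj₂)
  open import Data.Sum using (inj₁; inj₂)
  open import Relation.Binary.PropositionalEquality using (refl; sym; trans; cong; subst)

  Positive : List ℕ → Point → Point → Point → Set
  Positive ω P Q R = Minimal (tri P Q R) × orient P Q R ≡ 1ℤ × edgeWeights P Q R ↭ ω

  Flip : List ℕ → List ℕ → Set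
  Flip ω₁ ω₂ = ∃[ P ] ∃[ Q ] ∃[ R ] (Positive ω₁ P Q R × edgeWeights P R (fourth P Q R) ↭ ω₂)

  Congruences : List ℕ → List ℕ → Set
  Congruences ω₁ ω₂ =
    ∃[ u ] ∃[ v ] ∃[ w ] ∃[ x ] ∃[ y ] ∃[ z ]
      ( ω₁ ↭ (u ∷ v ∷ w ∷ []) × ω₂ ↭ (x ∷ y ∷ z ∷ [])
      × (u + x) % d ≡ 0
      × (v + y) % d ≡ 1 % d
      × (w + z) % d ≡ 1 % d )

  positive : ∀ {a} → a ≡ 1ℤ → 0ℤ ℤ.< a
  positive refl = +<+ (s≤s z≤n)

  weighted-positive : ∀ {ω P Q R} → MinimalOfWeight ω (tri P Q R) → orient P Q R ≡ 1ℤ → Positive ω P Q R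
  weighted-positive {P = P} {Q} {R} (minimal , weighted) area =
    minimal , area , ↭-trans (↭-reflexive (sym (weight-positive P Q R (positive area)))) weighted

  rotate-positive : ∀ {ω P Q R} → Positive ω P Q R → Positive ω Q R P
  rotate-positive {P = P} {Q} {R} (minimal , area , weighted) =
    minimal-rotate minimal , trans (orient-rotate P Q R) area , ↭-trans (↭-sym (↭-rotate _ _ _)) weighted

  -- Every minimal triangle has a positively oriented labelling, by unimodularity.
  positive-labelling : ∀ {ω A B C} → MinimalOfWeight ω (tri A B C) → ∃[ P ] ∃[ Q ] ∃[ R ] Positive ω P Q R
  positive-labelling {A = A} {B} {C} t with minimal⇒unimodular (proj₁ t)
  ... | inj₁ area = A , B , C , weighted-positive t area
  ... | inj₂ area = A , C , B , weighted-positive (swap t) (trans (orient-swap A B C) (cong -_ area))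

  reflected-weight : ∀ {ω P Q R} → orient P Q R ≡ 1ℤ →
    MinimalOfWeight ω (tri P R (fourth P Q R)) → edgeWeights P R (fourth P Q R) ↭ ω
  reflected-weight {P = P} {Q} {R} area (_ , weighted) =
    ↭-trans (↭-reflexive (sym (weight-positive P R _ (positive (trans (orient-fourth P Q R) area))))) weighted

  oriented-flip : ∀ {ω₁ ω₂ P Q R} → MinimalOfWeight ω₁ (tri P Q R) →
    MinimalOfWeight ω₂ (tri P R (fourth P Q R)) → Flip ω₁ ω₂
  oriented-flip {P = P} {Q} {R} t₁ t₂ with minimal⇒unimodular (proj₁ t₁)
  ... | inj₁ area = P , Q , R , weighted-positive t₁ area , reflected-weight area t₂
  ... | inj₂ area = R , Q , P , weighted-positive (rotate (swap t₁)) area′ , reflected-weight area′ t₂′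
    where
    area′ = trans (orient-reverse-order P Q R) (cong -_ area)
    t₂′ = subst (λ S → MinimalOfWeight _ (tri R P S)) (sym (fourth-symmetric P Q R)) (rotate (rotate (swap t₂)))

  -- The two forms of a pseudo-flip are equivalent: the parallelogram condition fixes the
  -- fourth vertex, and relabelling brings both triangles into the required order.
  pseudoFlippable⇒flip : ∀ {ω₁ ω₂} → PseudoFlippable d ω₁ ω₂ → Flip ω₁ ω₂
  pseudoFlippable⇒flip (tri _ _ _ , tri _ _ _ , m₁ , m₂ , w₁ , w₂ , P , Q , R , S , v₁ , v₂ , parallel)
    with parallelogram-fourth P Q R S parallel
  ... | refl = oriented-flip (relabel v₁ (m₁ , w₁)) (relabel v₂ (m₂ , w₂))

  flip⇒pseudoFlippable : ∀ {ω₁ ω₂} → Flip ω₁ ω₂ → PseudoFlippable d ω₁ ω₂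
  flip⇒pseudoFlippable (P , Q , R , (minimal , area , weighted₁) , weighted₂) =
    tri P Q R , tri P R S , minimal , minimal-fourth minimal ,
    ↭-trans (↭-reflexive (weight-positive P Q R (positive area))) weighted₁ ,
    ↭-trans (↭-reflexive (weight-positive P R S (positive (trans (orient-fourth P Q R) area)))) weighted₂ ,
    P , Q , R , S , ↭-refl , ↭-refl , fourth-parallelogram P Q R
    where
    S = fourth P Q R

  flip-congruences : ∀ P Q R → orient P Q R ≡ 1ℤ → let S = fourth P Q R in
    (w R P + w P R) % d ≡ 0 × (w P Q + w R S) % d ≡ 1 % d × (w Q R + w S P) % d ≡ 1 % d
  flip-congruences P Q R area =
    trans (residue-+ (det R P) (det P R)) (trans (cong (_%ℕ d) (det-antisymmetric P R)) zero-residue) ,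
    trans (residue-+ (det P Q) (det R S)) (cong (_%ℕ d) (trans (det-opposite₁ P Q R) area)) ,
    trans (residue-+ (det Q R) (det S P)) (cong (_%ℕ d) (trans (det-opposite₂ P Q R) area))
    where
    S = fourth P Q R

  -- First direction of the corollary: u, v, w on R P, P Q, Q R and x, y, z on P R, R S, S P.
  flip⇒congruences : ∀ {ω₁ ω₂} → Flip ω₁ ω₂ → Congruences ω₁ ω₂
  flip⇒congruences (P , Q , R , (_ , area , weighted₁) , weighted₂) =
    w R P , w P Q , w Q R , w P R , w R S , w S P ,
    ↭-trans (↭-sym weighted₁) (↭-sym (↭-rotate _ _ _)) , ↭-sym weighted₂ , flip-congruences P Q R area
    where
    S = fourth P Q R

  diagonal : ∀ {ω P Q R u v w′} → Positive ω P Q R → ω ↭ u ∷ v ∷ w′ ∷ [] →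
    ∃[ P′ ] ∃[ Q′ ] ∃[ R′ ] (Positive ω P′ Q′ R′ × u ≡ w R′ P′ × w P′ Q′ ∷ w Q′ R′ ∷ [] ↭ v ∷ w′ ∷ [])
  diagonal {P = P} {Q} {R} t@(_ , _ , weighted) p with ↭-head (↭-trans weighted p)
  ... | inj₁ (refl , rest)        = Q , R , P , rotate-positive t , refl , rest
  ... | inj₂ (inj₁ (refl , rest)) = R , P , Q , rotate-positive (rotate-positive t) , refl ,
                                      ↭-trans (↭-swap _ _ ↭-refl) rest
  ... | inj₂ (inj₂ (refl , rest)) = P , Q , R , t , refl , rest

  -- In a flip, the congruences determine each weight of the reflected triangle (below d)
  -- from the corresponding weight of the positive triangle.
  diagonal-partner : ∀ P Q R {x} → orient P Q R ≡ 1ℤ → (w R P + x) % d ≡ 0 → x < d → w P R ≡ x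
  diagonal-partner P Q R area c x<d =
    residue-cancelˡ (w R P) (weight-below P R) x<d (trans (proj₁ (flip-congruences P Q R area)) (sym c))

  side-partner₁ : ∀ P Q R {y} → orient P Q R ≡ 1ℤ → (w P Q + y) % d ≡ 1 % d → y < d → w R (fourth P Q R) ≡ y
  side-partner₁ P Q R area c y<d =
    residue-cancelˡ (w P Q) (weight-below R (fourth P Q R)) y<d (trans (proj₁ (proj₂ (flip-congruences P Q R area))) (sym c))

  side-partner₂ : ∀ P Q R {z} → orient P Q R ≡ 1ℤ → (w Q R + z) % d ≡ 1 % d → z < d → w (fourth P Q R) P ≡ z
  side-partner₂ P Q R area c z<d =
    residue-cancelˡ (w Q R) (weight-below (fourth P Q R) P) z<d (trans (proj₂ (proj₂ (flip-congruences P Q R area))) (sym c))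

  list₃-cong : ∀ {a b c a′ b′ c′ : ℕ} → a ≡ a′ → b ≡ b′ → c ≡ c′ → a ∷ b ∷ c ∷ [] ≡ a′ ∷ b′ ∷ c′ ∷ []
  list₃-cong refl refl refl = refl

  reflected-weights : ∀ P Q R {v w′ x y z} → orient P Q R ≡ 1ℤ →
    w P Q ∷ w Q R ∷ [] ↭ v ∷ w′ ∷ [] → All (_< d) (x ∷ y ∷ z ∷ []) →
    (w R P + x) % d ≡ 0 → (v + y) % d ≡ 1 % d → (w′ + z) % d ≡ 1 % d →
    edgeWeights P R (fourth P Q R) ↭ x ∷ y ∷ z ∷ []
  reflected-weights P Q R area rest (x<d All.∷ y<d All.∷ z<d All.∷ _) c₁ c₂ c₃ with ↭-pair rest
  ... | inj₁ (refl , refl) = ↭-reflexive (list₃-cong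
    (diagonal-partner P Q R area c₁ x<d) (side-partner₁ P Q R area c₂ y<d) (side-partner₂ P Q R area c₃ z<d))
  ... | inj₂ (refl , refl) = ↭-trans (↭-reflexive (list₃-cong
    (diagonal-partner P Q R area c₁ x<d) (side-partner₁ P Q R area c₃ z<d) (side-partner₂ P Q R area c₂ y<d)))
    (↭-prep _ (↭-swap _ _ ↭-refl))

  congruences⇒flip : ∀ {ω₁ ω₂} → WeightClass d ω₁ → WeightClass d ω₂ → Congruences ω₁ ω₂ → Flip ω₁ ω₂
  congruences⇒flip (tri _ _ _ , class₁) (T₂ , _ , weighted₂) (_ , _ , _ , x , y , z , p₁ , p₂ , c₁ , c₂ , c₃)
    with positive-labelling class₁
  ... | _ , _ , _ , t with diagonal t p₁
  ...   | P , Q , R , t′@(_ , area , _) , refl , rest =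
    P , Q , R , t′ , ↭-trans (reflected-weights P Q R area rest bounded c₁ c₂ c₃) (↭-sym p₂)
    where
    bounded : All (_< d) (x ∷ y ∷ z ∷ [])
    bounded = All-resp-↭ (↭-trans weighted₂ p₂) (weight-bounded T₂)

-- The statement uses the natural-number operations, opened only here to avoid clashing with
-- the integer operations of the modules above.
open import Data.Nat using (_+_; _%_)
open import Function.Bundles using (_⇔_; mk⇔)

corollary4p2 : (d : ℕ) .{{_ : NonZero d}} (ω₁ ω₂ : List ℕ) →
    WeightClass d ω₁ → WeightClass d ω₂ →
    PseudoFlippable d ω₁ ω₂ ⇔
      (∃[ u ] ∃[ v ] ∃[ w ] ∃[ x ] ∃[ y ] ∃[ z ]
        ( ω₁ ↭ (u ∷ v ∷ w ∷ []) × ω₂ ↭ (x ∷ y ∷ z ∷ [])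
        × (u + x) % d ≡ 0
        × (v + y) % d ≡ 1 % d
        × (w + z) % d ≡ 1 % d ))
corollary4p2 d ω₁ ω₂ class₁ class₂ = mk⇔
  (λ flippable → flip⇒congruences (pseudoFlippable⇒flip flippable))
  (λ congruences → flip⇒pseudoFlippable (congruences⇒flip class₁ class₂ congruences))
  where open Flips d
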